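{- Let $\mathbb S$ be a finite commutative semiring. For each fixed $s\in\mathbb S$ and $k\in\mathbb N$ there is a family $(C_n)_{n\in\mathbb N}$ of circuits with counting gates, where $C_n$ has $n$ boolean inputs and outputs $(\ell-k)\cdot s$, $\ell$ being the number of $1$'s among its inputs. The family has bounded depth, bounded fan-out, and bounded expansion, every threshold is at most $O(|\mathbb S|+k)$, and the modulus of each mod gate is the order of some cyclic subgroup of $(\mathbb S,+)$.
   Context: For an integer $m$ and $s\in\mathbb S$, $m\cdot s$ denotes the $m$-fold sum $s+\dots+s$ if $m\ge1$ and $0$ otherwise. A boolean is $0$ or $1$ of $\mathbb S$. A circuit with counting gates is a directed acyclic graph of gates with a distinguished output gate, consisting of input gates, constant gates labelled by elements of $\mathbb S$, multiplication gates (fan-in 2), addition gates (arbitrary fan-in), test gates (parameterized by $s\in\mathbb S$; input $t\in\mathbb S$; output $1$ if $s=t$, else $0$), mod gates with modulus $m$ (input booleans; output $1$ iff the number of $1$'s is a multiple of $m$, else $0$), and threshold gates with threshold $t$ (input booleans; output $1$ iff at least $t$ inputs are $1$, else $0$). Depth: maximal directed path length; fan-out: maximal out-degree. The family has bounded expansion if the class of underlying undirected graphs of the circuits $C_n$ has bounded expansion, i.e. for every $r$ there is $c_r$ such that every graph obtained from one of them by deleting vertices/edges and contracting disjoint connected subgraphs of radius $\le r$ has at most $c_r$ times as many edges as vertices. -}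

module Defs where

open import Data.Nat using (ℕ; zero; suc; _+_; _*_; _≤_; _<_; _⊔_; _≤?_; _<?_)
open import Data.Nat.Divisibility using (_∣_; _∣?_)
open import Data.Fin using (Fin; toℕ) renaming (_≟_ to _≟ᶠ_)
open import Data.Bool using (Bool; true; false; if_then_else_; _∧_)
open import Data.Maybe using (Maybe; just)
open import Data.List using (List; []; _∷_; _++_; [_]; map; foldr; length; lookup; allFin; filter; concatMap; replicate)
open import Data.List.Relation.Unary.All using (All)
open import Data.List.Relation.Unary.Any using (any?)
open import Data.List.Relation.Unary.Unique.Propositional using (Unique)
open import Data.List.Membership.Propositional using (_∈_)
open import Data.Product using (Σ; ∃; ∃-syntax; _×_; _,_)
open import Data.Sum using (_⊎_)
open import Data.Unit using (⊤)
open import Data.Empty using (⊥)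
open import Relation.Nullary using (¬_)
open import Relation.Nullary.Decidable using (⌊_⌋)
open import Relation.Binary.PropositionalEquality using (_≡_)
open import Algebra.Structures using (IsCommutativeSemiring)
open import Function using (_∘_)

-- A finite commutative semiring, presented (up to isomorphism) on the
-- carrier Fin card with propositional equality; |𝕊| = card.

record FinCSR : Set where
  field
    card  : ℕ
    _⊕_   : Fin card → Fin card → Fin card
    _⊗_   : Fin card → Fin card → Fin card
    𝟘     : Fin card
    𝟙     : Fin card
    isCSR : IsCommutativeSemiring _≡_ _⊕_ _⊗_ 𝟘 𝟙

lookupD : {A : Set} → A → List A → ℕ → A
lookupD d []       _       = d
lookupD d (x ∷ xs) zero    = x
lookupD d (x ∷ xs) (suc i) = lookupD d xs i

maxL : List ℕ → ℕ
maxL = foldr _⊔_ 0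

data WalkIn {V : Set} (A : V → V → Set) (P : V → Set) : ℕ → V → V → Set where
  stop : ∀ {x} → P x → WalkIn A P 0 x x
  step : ∀ {l x y z} → P x → A x y → WalkIn A P l y z → WalkIn A P (suc l) x z

-- an r-shallow minor H (on vertex set Fin k, edge relation given by E on
-- pairs u < v) of the graph with vertex set Fin N and adjacency Adj:
-- disjoint branch sets (given by a partial map), each of radius ≤ r
-- around a centre inside its own induced subgraph, and every edge of H
-- is realised by an edge of G between the corresponding branch sets.
record ShallowMinor (r N : ℕ) (Adj : Fin N → Fin N → Set) : Set where
  field
    k      : ℕ
    E      : Fin k → Fin k → Bool
    branch : Fin N → Maybe (Fin k)
    centre : Fin k → Fin N
    centre-in : ∀ v → branch (centre v) ≡ just v
    radius : ∀ v x → branch x ≡ just v →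
             ∃[ l ] (l ≤ r × WalkIn Adj (λ y → branch y ≡ just v) l (centre v) x)
    edges  : ∀ u v → toℕ u < toℕ v → E u v ≡ true →
             ∃[ x ] ∃[ y ] (branch x ≡ just u × branch y ≡ just v × Adj x y)

  edgeCount : ℕ
  edgeCount = length (filter (λ p → Data.Bool._≟_ (⌊ toℕ (Data.Product.proj₁ p) <? toℕ (Data.Product.proj₂ p) ⌋ ∧ E (Data.Product.proj₁ p) (Data.Product.proj₂ p)) true)
                  (concatMap (λ u → map (λ v → (u , v)) (allFin k)) (allFin k)))

module Circuits (𝕊 : FinCSR) where
  open FinCSR 𝕊

  S : Set
  S = Fin card

  times : ℕ → S → S
  times zero    s = 𝟘
  times (suc m) s = s ⊕ times m s

  data Kind : Set where
    const : S → Kind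
    mul   : Kind
    add   : Kind
    test  : S → Kind
    modg  : ℕ → Kind
    thr   : ℕ → Kind

  record Gate : Set where
    constructor gate
    field
      kind : Kind
      args : List ℕ
  open Gate public

  -- A circuit with n inputs: nodes 0 … n-1 are the input gates (node i
  -- reads input i); node n + j is the j-th entry of 'gates', whose
  -- arguments must be earlier nodes (this makes the graph acyclic).
  record Circuit (n : ℕ) : Set where
    field
      gates  : List Gate
      output : ℕ
  open Circuit public

  size : ∀ {n} → Circuit n → ℕ
  size {n} C = n + length (gates C)

  ArityOK : Kind → List ℕ → Set
  ArityOK (const _) as = length as ≡ 0
  ArityOK mul       as = length as ≡ 2
  ArityOK add       as = ⊤
  ArityOK (test _)  as = length as ≡ 1
  ArityOK (modg _)  as = ⊤
  ArityOK (thr _)   as = ⊤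

  WellFormed : ∀ {n} → Circuit n → Set
  WellFormed {n} C =
    (∀ (j : Fin (length (gates C))) →
      let g = lookup (gates C) j in
      All (_< n + toℕ j) (args g) × Unique (args g) × ArityOK (kind g) (args g))
    × output C < size C

  count1 : List S → ℕ
  count1 vs = length (filter (_≟ᶠ 𝟙) vs)

  bit : Bool → S
  bit b = if b then 𝟙 else 𝟘

  mul2 : List S → S
  mul2 (a ∷ b ∷ _) = a ⊗ b
  mul2 _           = 𝟘

  testV : S → List S → S
  testV s (v ∷ _) = bit ⌊ v ≟ᶠ s ⌋
  testV s []      = 𝟘

  gateVal : Kind → List S → S
  gateVal (const c) vs = c
  gateVal mul       vs = mul2 vs
  gateVal add       vs = foldr _⊕_ 𝟘 vs
  gateVal (test s)  vs = testV s vs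
  gateVal (modg m)  vs = bit ⌊ m ∣? count1 vs ⌋
  gateVal (thr t)   vs = bit ⌊ t ≤? count1 vs ⌋

  evalFrom : List S → List Gate → List S
  evalFrom vals []       = vals
  evalFrom vals (g ∷ gs) =
    evalFrom (vals ++ [ gateVal (kind g) (map (lookupD 𝟘 vals) (args g)) ]) gs

  values : ∀ {n} → Circuit n → (Fin n → Bool) → List S
  values {n} C x = evalFrom (map (bit ∘ x) (allFin n)) (gates C)

  outputVal : ∀ {n} → Circuit n → (Fin n → Bool) → S
  outputVal C x = lookupD 𝟘 (values C x) (output C)

  ones : ∀ {n} → (Fin n → Bool) → ℕ
  ones {n} x = length (filter (λ i → Data.Bool._≟_ (x i) true) (allFin n))

  IsBool : S → Set
  IsBool v = v ≡ 𝟘 ⊎ v ≡ 𝟙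

  IsCounting : Kind → Set
  IsCounting (modg _) = ⊤
  IsCounting (thr _)  = ⊤
  IsCounting _        = ⊥

  CountingInputsBoolean : ∀ {n} → Circuit n → Set
  CountingInputsBoolean C = ∀ x (j : Fin (length (gates C))) →
    IsCounting (kind (lookup (gates C) j)) →
    All (λ i → IsBool (lookupD 𝟘 (values C x) i)) (args (lookup (gates C) j))

  -- depth = length (in edges) of a longest directed path
  depthFrom : List ℕ → List Gate → List ℕ
  depthFrom ds []       = ds
  depthFrom ds (g ∷ gs) = depthFrom (ds ++ [ gd (args g) ]) gs
    where
      gd : List ℕ → ℕ
      gd []         = 0
      gd as@(_ ∷ _) = suc (maxL (map (lookupD 0 ds) as))

  depth : ∀ {n} → Circuit n → ℕ
  depth {n} C = maxL (depthFrom (replicate n 0) (gates C))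

  outdeg : ∀ {n} → Circuit n → ℕ → ℕ
  outdeg C i = length (filter (λ g → any? (Data.Nat._≟_ i) (args g)) (gates C))

  DirEdge : ∀ {n} (C : Circuit n) → Fin (size C) → Fin (size C) → Set
  DirEdge {n} C a b = ∃[ j ] (n + toℕ {length (gates C)} j ≡ toℕ b × toℕ a ∈ args (lookup (gates C) j))

  Adj : ∀ {n} (C : Circuit n) → Fin (size C) → Fin (size C) → Set
  Adj C a b = DirEdge C a b ⊎ DirEdge C b a

  -- the moduli allowed: orders of cyclic subgroups of the finite
  -- semigroup (𝕊,+): a group {g, 2g, …, m·g = e} with identity the
  -- idempotent e, generated by g, of order m
  CyclicSubgroupOrder : ℕ → Set
  CyclicSubgroupOrder m = ∃[ g ] ∃[ e ]
    ( e ⊕ e ≡ e × e ⊕ g ≡ g × 1 ≤ m × times m g ≡ e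
    × (∀ p → 1 ≤ p → p < m → ¬ (times p g ≡ e)) )

  KindOK : ℕ → Kind → Set
  KindOK b (thr t)  = t ≤ b
  KindOK b (modg m) = CyclicSubgroupOrder m
  KindOK b _        = ⊤

  Family : Set
  Family = (n : ℕ) → Circuit n

  BoundedDepth : Family → Set
  BoundedDepth F = ∃[ d ] (∀ n → depth (F n) ≤ d)

  BoundedFanOut : Family → Set
  BoundedFanOut F = ∃[ f ] (∀ n i → outdeg (F n) i ≤ f)

  BoundedExpansion : Family → Set
  BoundedExpansion F = ∀ r → ∃[ c ] (∀ n (H : ShallowMinor r (size (F n)) (Adj (F n))) →
    ShallowMinor.edgeCount H ≤ c * ShallowMinor.k H)

module Submission where

-- Let ℓ be the number of ones. The threshold gates [k + j ≤ ℓ], 1 ≤ j ≤ |𝕊|, add up to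
-- min(ℓ ∸ k, |𝕊|)·1, which settles ℓ < k + |𝕊|. Otherwise ℓ ∸ k ≥ |𝕊|, and by pigeonhole
-- m ↦ m·s is periodic from |𝕊| on, with some period p + 1; hence
-- (ℓ ∸ k)·s = (ℓ ∸ k + (k + |𝕊|)(p + 1))·s = |𝕊|·s + (ℓ + (k + |𝕊|)p)·s, and the second
-- summand is linear in ℓ, so one gate [k + |𝕊| ≤ ℓ] switches it on. No mod gates are needed.
-- The circuit has |𝕊| + 10 gates besides the inputs, and no two inputs are adjacent, so
-- depth, fan-out and the edge density of shallow minors are bounded independently of n.

open import Defs
open import Data.Nat using (ℕ; _+_; _*_; _∸_; _≤_)
open import Data.Product using (Σ; ∃-syntax; _×_)
open import Data.List.Relation.Unary.All using (All)
open import Relation.Binary.PropositionalEquality using (_≡_)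

open import Data.Nat
open import Data.Nat.Properties
open import Data.Nat.Tactic.RingSolver using (solve-∀)
open import Data.Bool using (Bool; true; false; _∨_; _∧_)
import Data.Bool as Bool
open import Data.Bool.Properties using (∨-zeroʳ)
open import Data.Bool.ListAction using (any)
open import Data.Maybe using (Maybe; just; nothing; maybe)
open import Data.Fin using (Fin; toℕ; zero; suc; _↑ʳ_) renaming (_≟_ to _≟ᶠ_)
open import Data.Fin.Properties using (toℕ-injective; toℕ-↑ʳ; pigeonhole; toℕ<n)
open import Data.Product using (_,_; proj₁; proj₂)
open import Data.Sum using (inj₁; inj₂)
open import Data.Unit using (tt)
open import Data.List using (List; []; _∷_; _++_; [_]; map; length; filter; foldr; concatMap; lookup; allFin; replicate)
open import Data.List.Properties using (length-++; ++-assoc; ++-identityʳ; length-filter; length-map; length-tabulate)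
open import Data.List.Relation.Unary.All as All using ([]; _∷_; universal)
open import Data.List.Relation.Unary.All.Properties using (map⁺; map⁻; ++⁺)
open import Data.List.Relation.Unary.Any using (here; there)
open import Data.List.Relation.Unary.AllPairs using ([]; _∷_)
open import Data.List.Relation.Unary.Unique.Propositional using (Unique)
open import Data.List.Relation.Unary.Unique.Propositional.Properties using (allFin⁺)
open import Data.List.Membership.Propositional using (_∈_)
open import Data.List.Membership.Propositional.Properties using (∈-allFin; ∈-lookup)
open import Relation.Nullary using (yes; no; does)
open import Relation.Nullary.Decidable using (⌊_⌋; True; False; toWitness; toWitnessFalse; dec-true; dec-false)
open import Relation.Binary.PropositionalEquality using (_≢_; refl; sym; trans; cong; cong₂; subst; module ≡-Reasoning)
open import Algebra.Structures using (IsCommutativeSemiring)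
open import Function using (_∘_; id)

-- Phrased with filter so that ones and ShallowMinor.edgeCount are counts by definition.
count : {A : Set} → (A → Bool) → List A → ℕ
count f xs = length (filter (λ a → f a Bool.≟ true) xs)

module _ {A : Set} where

  count-++ : ∀ (f : A → Bool) xs ys → count f (xs ++ ys) ≡ count f xs + count f ys
  count-++ f [] ys = refl
  count-++ f (x ∷ xs) ys with f x
  ... | true  = cong suc (count-++ f xs ys)
  ... | false = count-++ f xs ys

  count-none : ∀ {f : A → Bool} {xs} → All (λ x → f x ≡ false) xs → count f xs ≡ 0
  count-none [] = refl
  count-none {f} (fx≡false ∷ fxs) rewrite fx≡false = count-none fxs

  count-false : ∀ (xs : List A) → count (λ _ → false) xs ≡ 0
  count-false [] = refl
  count-false (_ ∷ xs) = count-false xs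

  count-true : ∀ (xs : List A) → count (λ _ → true) xs ≡ length xs
  count-true [] = refl
  count-true (_ ∷ xs) = cong suc (count-true xs)

  count-map : ∀ {B : Set} (f : B → Bool) (g : A → B) xs → count f (map g xs) ≡ count (f ∘ g) xs
  count-map f g [] = refl
  count-map f g (x ∷ xs) with f (g x)
  ... | true  = cong suc (count-map f g xs)
  ... | false = count-map f g xs

  count-mono : ∀ {f g : A → Bool} → (∀ x → f x ≡ true → g x ≡ true) → ∀ xs → count f xs ≤ count g xs
  count-mono f⇒g [] = z≤n
  count-mono {f} {g} f⇒g (x ∷ xs) with f x in fx | g x in gx
  ... | true  | true  = s≤s (count-mono f⇒g xs)
  ... | false | true  = m≤n⇒m≤1+n (count-mono f⇒g xs)
  ... | false | false = count-mono f⇒g xs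
  ... | true  | false with () ← trans (sym gx) (f⇒g x fx)

  count-∨ : ∀ (f g : A → Bool) xs → count (λ x → f x ∨ g x) xs ≤ count f xs + count g xs
  count-∨ f g [] = z≤n
  count-∨ f g (x ∷ xs) with f x | g x
  ... | true  | true  = s≤s (≤-trans (count-∨ f g xs) (+-monoʳ-≤ (count f xs) (n≤1+n _)))
  ... | true  | false = s≤s (count-∨ f g xs)
  ... | false | true  = ≤-trans (s≤s (count-∨ f g xs)) (≤-reflexive (sym (+-suc _ _)))
  ... | false | false = count-∨ f g xs

  any-true : ∀ {p : A → Bool} {x xs} → x ∈ xs → p x ≡ true → any p xs ≡ true
  any-true {p} {xs = _ ∷ ys} (here refl) px = cong (_∨ any p ys) px
  any-true {p} {xs = y ∷ _} (there x∈xs) px = trans (cong (p y ∨_) (any-true x∈xs px)) (∨-zeroʳ (p y))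

  count-any : ∀ {B : Set} (g : B → A → Bool) xs (js : List B) → (∀ j → count (g j) xs ≤ 1) →
              count (λ x → any (λ j → g j x) js) xs ≤ length js
  count-any g xs [] _ = ≤-reflexive (count-false xs)
  count-any g xs (j ∷ js) g≤1 = ≤-trans (count-∨ (g j) _ xs) (+-mono-≤ (g≤1 j) (count-any g xs js g≤1))


module _ {A B : Set} where

  pairs : List A → List B → List (A × B)
  pairs xs ys = concatMap (λ x → map (x ,_) ys) xs

  count-pairs-proj₁ : ∀ (f : A → Bool) xs ys → count (f ∘ proj₁) (pairs xs ys) ≡ count f xs * length ys
  count-pairs-proj₁ f [] ys = refl
  count-pairs-proj₁ f (x ∷ xs) ys = begin
    count (f ∘ proj₁) (map (x ,_) ys ++ pairs xs ys)
      ≡⟨ count-++ (f ∘ proj₁) (map (x ,_) ys) (pairs xs ys) ⟩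
    count (f ∘ proj₁) (map (x ,_) ys) + count (f ∘ proj₁) (pairs xs ys)
      ≡⟨ cong₂ _+_ (count-map (f ∘ proj₁) (x ,_) ys) (count-pairs-proj₁ f xs ys) ⟩
    count (λ _ → f x) ys + count f xs * length ys
      ≡⟨ head-row (f x) refl ⟩
    count f (x ∷ xs) * length ys ∎
    where
      open ≡-Reasoning
      head-row : ∀ b → f x ≡ b → count (λ _ → b) ys + count f xs * length ys ≡ count f (x ∷ xs) * length ys
      head-row true  fx rewrite fx = cong (_+ count f xs * length ys) (count-true ys)
      head-row false fx rewrite fx = cong (_+ count f xs * length ys) (count-false ys)

  count-pairs-proj₂ : ∀ (g : B → Bool) xs ys → count (g ∘ proj₂) (pairs xs ys) ≡ length xs * count g ys
  count-pairs-proj₂ g [] ys = refl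
  count-pairs-proj₂ g (x ∷ xs) ys = begin
    count (g ∘ proj₂) (map (x ,_) ys ++ pairs xs ys)
      ≡⟨ count-++ (g ∘ proj₂) (map (x ,_) ys) (pairs xs ys) ⟩
    count (g ∘ proj₂) (map (x ,_) ys) + count (g ∘ proj₂) (pairs xs ys)
      ≡⟨ cong₂ _+_ (count-map (g ∘ proj₂) (x ,_) ys) (count-pairs-proj₂ g xs ys) ⟩
    count g ys + length xs * count g ys ∎
    where open ≡-Reasoning

count-≟-≤1 : ∀ {k} (v : Fin k) {xs} → Unique xs → count (λ u → does (v ≟ᶠ u)) xs ≤ 1
count-≟-≤1 v [] = z≤n
count-≟-≤1 v {x ∷ xs} (x∉xs ∷ uxs) with v ≟ᶠ x
... | yes refl = s≤s (≤-reflexive (count-none (All.map (dec-false (v ≟ᶠ _)) x∉xs)))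
... | no _ = count-≟-≤1 v uxs

interval : ℕ → ℕ → List ℕ
interval a zero    = []
interval a (suc c) = a ∷ interval (suc a) c

All-interval< : ∀ a c {o} → a + c ≤ o → All (_< o) (interval a c)
All-interval< a zero    _ = []
All-interval< a (suc c) a+1+c≤o rewrite +-suc a c = m+n≤o⇒m≤o (suc a) a+1+c≤o ∷ All-interval< (suc a) c a+1+c≤o

All-interval≥ : ∀ a c {b} → b ≤ a → All (b ≤_) (interval a c)
All-interval≥ a zero    _   = []
All-interval≥ a (suc c) b≤a = b≤a ∷ All-interval≥ (suc a) c (m≤n⇒m≤1+n b≤a)

interval-unique : ∀ a c → Unique (interval a c)
interval-unique a zero    = []
interval-unique a (suc c) =
  All.map (λ a<x a≡x → <⇒≢ a<x a≡x) (All-interval≥ (suc a) c ≤-refl) ∷ interval-unique (suc a) c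

module _ {A : Set} (d : A) where

  lookupD-++ˡ : ∀ xs ys {i} → i < length xs → lookupD d (xs ++ ys) i ≡ lookupD d xs i
  lookupD-++ˡ (x ∷ xs) ys {zero}  _         = refl
  lookupD-++ˡ (x ∷ xs) ys {suc i} (s≤s i<n) = lookupD-++ˡ xs ys i<n

  lookupD-++ʳ : ∀ xs ys j {m} → length xs ≡ m → lookupD d (xs ++ ys) (j + m) ≡ lookupD d ys j
  lookupD-++ʳ xs ys j refl rewrite +-comm j (length xs) = go xs
    where
      go : ∀ xs → lookupD d (xs ++ ys) (length xs + j) ≡ lookupD d ys j
      go []       = refl
      go (_ ∷ xs) = go xs

  map-lookupD-++ˡ : ∀ xs ys {is} → All (_< length xs) is → map (lookupD d (xs ++ ys)) is ≡ map (lookupD d xs) is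
  map-lookupD-++ˡ xs ys []         = refl
  map-lookupD-++ˡ xs ys (i<n ∷ is) = cong₂ _∷_ (lookupD-++ˡ xs ys i<n) (map-lookupD-++ˡ xs ys is)

  map-lookupD-interval : ∀ xs ys zs {a} → length xs ≡ a → map (lookupD d (xs ++ ys ++ zs)) (interval a (length ys)) ≡ ys
  map-lookupD-interval xs []       zs _      = refl
  map-lookupD-interval xs (y ∷ ys) zs |xs|≡a =
    cong₂ _∷_ (lookupD-++ʳ xs (y ∷ ys ++ zs) 0 |xs|≡a)
              (subst (λ vs → map (lookupD d vs) (interval (suc _) (length ys)) ≡ ys) (++-assoc xs [ y ] (ys ++ zs))
                     (map-lookupD-interval (xs ++ [ y ]) ys zs |xs++y|≡1+a))
    where
      |xs++y|≡1+a : length (xs ++ [ y ]) ≡ suc _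
      |xs++y|≡1+a = trans (length-++ xs) (trans (+-comm (length xs) 1) (cong suc |xs|≡a))

maxL-++ : ∀ xs ys → maxL (xs ++ ys) ≡ maxL xs ⊔ maxL ys
maxL-++ []       ys = refl
maxL-++ (x ∷ xs) ys = trans (cong (x ⊔_) (maxL-++ xs ys)) (sym (⊔-assoc x (maxL xs) (maxL ys)))

lookupD≤maxL : ∀ xs i → lookupD 0 xs i ≤ maxL xs
lookupD≤maxL []       i       = z≤n
lookupD≤maxL (x ∷ xs) zero    = m≤m⊔n x (maxL xs)
lookupD≤maxL (x ∷ xs) (suc i) = ≤-trans (lookupD≤maxL xs i) (m≤n⊔m x (maxL xs))

maxL-map-lookupD : ∀ xs is → maxL (map (lookupD 0 xs) is) ≤ maxL xs
maxL-map-lookupD xs []       = z≤n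
maxL-map-lookupD xs (i ∷ is) = ⊔-lub (lookupD≤maxL xs i) (maxL-map-lookupD xs is)

maxL-replicate-0 : ∀ n → maxL (replicate n 0) ≡ 0
maxL-replicate-0 zero    = refl
maxL-replicate-0 (suc n) = maxL-replicate-0 n

maxL-∷ʳ-≤ : ∀ xs {e} m → e ≤ suc (maxL xs) → maxL (xs ++ [ e ]) + m ≤ maxL xs + suc m
maxL-∷ʳ-≤ xs m e≤ = begin
  maxL (xs ++ [ _ ]) + m  ≡⟨ cong (_+ m) (maxL-++ xs [ _ ]) ⟩
  (maxL xs ⊔ (_ ⊔ 0)) + m ≤⟨ +-monoˡ-≤ m (⊔-lub (n≤1+n (maxL xs)) (⊔-lub e≤ z≤n)) ⟩
  suc (maxL xs) + m       ≡⟨ sym (+-suc (maxL xs) m) ⟩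
  maxL xs + suc m         ∎
  where open ≤-Reasoning

∸≡suc∸suc : ∀ {m n} → suc n ≤ m → m ∸ n ≡ suc (m ∸ suc n)
∸≡suc∸suc {suc m} {zero}  _         = refl
∸≡suc∸suc {suc m} {suc n} (s≤s n<m) = ∸≡suc∸suc n<m

module _ (𝕊 : FinCSR) where
  open FinCSR 𝕊
  open Circuits 𝕊
  private module R = IsCommutativeSemiring isCSR

  maxL-depthFrom : ∀ ds gs → maxL (depthFrom ds gs) ≤ maxL ds + length gs
  maxL-depthFrom ds []                       = m≤m+n (maxL ds) 0
  maxL-depthFrom ds (gate _ [] ∷ gs)         =
    ≤-trans (maxL-depthFrom (ds ++ [ 0 ]) gs) (maxL-∷ʳ-≤ ds (length gs) z≤n)
  maxL-depthFrom ds (gate _ is@(_ ∷ _) ∷ gs) =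
    ≤-trans (maxL-depthFrom (ds ++ [ _ ]) gs) (maxL-∷ʳ-≤ ds (length gs) (s≤s (maxL-map-lookupD ds is)))

  depth≤#gates : ∀ {n} (C : Circuit n) → depth C ≤ length (gates C)
  depth≤#gates {n} C = subst (λ m → depth C ≤ m + length (gates C)) (maxL-replicate-0 n)
                               (maxL-depthFrom (replicate n 0) (gates C))

  outdeg≤#gates : ∀ {n} (C : Circuit n) i → outdeg C i ≤ length (gates C)
  outdeg≤#gates C i = length-filter _ (gates C)

  -- Input nodes are pairwise non-adjacent, so every edge of the minor has an
  -- endpoint whose branch set contains a gate node; there are at most
  -- #gates such branch vertices.
  edgeCount≤2#gates*k : ∀ {n} (C : Circuit n) {r} (H : ShallowMinor r (size C) (Adj C)) →
                        ShallowMinor.edgeCount H ≤ (length (gates C) + length (gates C)) * ShallowMinor.k H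
  edgeCount≤2#gates*k {n} C H = begin
    edgeCount
      ≤⟨ count-mono edge⇒touched vertexPairs ⟩
    count (λ p → touched (proj₁ p) ∨ touched (proj₂ p)) vertexPairs
      ≤⟨ count-∨ (touched ∘ proj₁) (touched ∘ proj₂) vertexPairs ⟩
    count (touched ∘ proj₁) vertexPairs + count (touched ∘ proj₂) vertexPairs
      ≡⟨ cong₂ _+_ (count-pairs-proj₁ touched (allFin k) (allFin k)) (count-pairs-proj₂ touched (allFin k) (allFin k)) ⟩
    #touched * length (allFin k) + length (allFin k) * #touched
      ≡⟨ cong (λ l → #touched * l + l * #touched) (length-tabulate {n = k} id) ⟩
    #touched * k + k * #touched
      ≡⟨ cong (#touched * k +_) (*-comm k #touched) ⟩
    #touched * k + #touched * k
      ≡⟨ sym (*-distribʳ-+ k #touched #touched) ⟩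
    (#touched + #touched) * k
      ≤⟨ *-monoˡ-≤ k (+-mono-≤ #touched≤M #touched≤M) ⟩
    (M + M) * k ∎
    where
      open ShallowMinor H
      open ≤-Reasoning
      M : ℕ
      M = length (gates C)

      vertexPairs : List (Fin k × Fin k)
      vertexPairs = pairs (allFin k) (allFin k)

      gateNode : Fin M → Fin (size C)
      gateNode j = n ↑ʳ j

      hits : Maybe (Fin k) → Fin k → Bool
      hits b u = maybe (λ v → does (v ≟ᶠ u)) false b

      touched : Fin k → Bool
      touched u = any (λ j → hits (branch (gateNode j)) u) (allFin M)

      #touched : ℕ
      #touched = count touched (allFin k)

      #touched≤M : #touched ≤ M
      #touched≤M = ≤-trans (count-any (λ j → hits (branch (gateNode j))) (allFin k) (allFin M) hits≤1)
                           (≤-reflexive (length-tabulate {n = M} id))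
        where
          hits≤1 : ∀ j → count (hits (branch (gateNode j))) (allFin k) ≤ 1
          hits≤1 j with branch (gateNode j)
          ... | nothing = ≤-trans (≤-reflexive (count-false (allFin k))) z≤n
          ... | just v  = count-≟-≤1 v (allFin⁺ k)

      touched-gate : ∀ {x u} j → branch x ≡ just u → n + toℕ j ≡ toℕ x → touched u ≡ true
      touched-gate {x} {u} j bx≡u n+j≡x = any-true (∈-allFin j)
        (trans (cong (λ b → hits b u) (trans (cong branch gateNode-j≡x) bx≡u)) (dec-true (u ≟ᶠ u) refl))
        where
          gateNode-j≡x : gateNode j ≡ x
          gateNode-j≡x = toℕ-injective (trans (toℕ-↑ʳ n j) n+j≡x)

      edge⇒touched : ∀ p → (⌊ toℕ (proj₁ p) <? toℕ (proj₂ p) ⌋ ∧ E (proj₁ p) (proj₂ p)) ≡ true →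
                     (touched (proj₁ p) ∨ touched (proj₂ p)) ≡ true
      edge⇒touched (u , v) e with toℕ u <? toℕ v
      ... | yes u<v with edges u v u<v e
      ...   | _ , _ , _  , bv , inj₁ (j , n+j≡y , _) rewrite touched-gate j bv n+j≡y = ∨-zeroʳ (touched u)
      ...   | _ , _ , bu , _  , inj₂ (j , n+j≡x , _) rewrite touched-gate j bu n+j≡x = refl

  𝟘≡𝟙⇒trivial : 𝟘 ≡ 𝟙 → ∀ (a b : S) → a ≡ b
  𝟘≡𝟙⇒trivial 𝟘≡𝟙 a b = trans (≡𝟘 a) (sym (≡𝟘 b))
    where
      ≡𝟘 : ∀ a → a ≡ 𝟘
      ≡𝟘 a = trans (sym (R.*-identityʳ a)) (trans (cong (a ⊗_) (sym 𝟘≡𝟙)) (R.zeroʳ a))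

  times-+ : ∀ m n s → times (m + n) s ≡ times m s ⊕ times n s
  times-+ zero    n s = sym (R.+-identityˡ (times n s))
  times-+ (suc m) n s = trans (cong (s ⊕_) (times-+ m n s)) (sym (R.+-assoc s _ _))

  times-𝟙-⊗ : ∀ m s → times m 𝟙 ⊗ s ≡ times m s
  times-𝟙-⊗ zero    s = R.zeroˡ s
  times-𝟙-⊗ (suc m) s = trans (R.distribʳ s 𝟙 (times m 𝟙)) (cong₂ _⊕_ (R.*-identityˡ s) (times-𝟙-⊗ m s))

  times-shift : ∀ {s i p m} → times (i + p) s ≡ times i s → i ≤ m → times (m + p) s ≡ times m s
  times-shift {s} {i} {p} {m} period i≤m = begin
    times (m + p) s               ≡⟨ cong (λ l → times (l + p) s) (sym (m∸n+n≡m i≤m)) ⟩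
    times (m ∸ i + i + p) s       ≡⟨ cong (λ l → times l s) (+-assoc (m ∸ i) i p) ⟩
    times (m ∸ i + (i + p)) s     ≡⟨ times-+ (m ∸ i) (i + p) s ⟩
    times (m ∸ i) s ⊕ times (i + p) s ≡⟨ cong (times (m ∸ i) s ⊕_) period ⟩
    times (m ∸ i) s ⊕ times i s   ≡⟨ sym (times-+ (m ∸ i) i s) ⟩
    times (m ∸ i + i) s           ≡⟨ cong (λ l → times l s) (m∸n+n≡m i≤m) ⟩
    times m s                     ∎
    where open ≡-Reasoning

  times-periodic : ∀ {s i p} → times (i + p) s ≡ times i s → ∀ m q → i ≤ m → times (m + q * p) s ≡ times m s
  times-periodic {s} {i} {p} period m zero    i≤m = cong (λ l → times l s) (+-identityʳ m)
  times-periodic {s} {i} {p} period m (suc q) i≤m = begin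
    times (m + (p + q * p)) s ≡⟨ cong (λ l → times l s) (reorder m p (q * p)) ⟩
    times (m + q * p + p) s   ≡⟨ times-shift period (≤-trans i≤m (m≤m+n m (q * p))) ⟩
    times (m + q * p) s       ≡⟨ times-periodic period m q i≤m ⟩
    times m s                 ∎
    where
      open ≡-Reasoning
      reorder : ∀ a b c → a + (b + c) ≡ a + c + b
      reorder = solve-∀

  -- Pigeonhole on the card + 1 values 0·s, …, card·s.
  times-eventually-periodic : ∀ s → ∃[ p ] (∀ m q → card ≤ m → times (m + q * suc p) s ≡ times m s)
  times-eventually-periodic s with pigeonhole (n<1+n card) (λ t → times (toℕ t) s)
  ... | i , j , i<j , i·s≡j·s = toℕ j ∸ suc (toℕ i) , λ m q card≤m →
    times-periodic (sym (trans i·s≡j·s (cong (λ l → times l s) j≡i+p))) m q (≤-trans (≤-pred (toℕ<n i)) card≤m)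
    where
      j≡i+p : toℕ j ≡ toℕ i + suc (toℕ j ∸ suc (toℕ i))
      j≡i+p = sym (trans (+-suc (toℕ i) _) (m+[n∸m]≡n i<j))

  module _ {n} (x : Fin n → Bool) where

    sum-bits : ∀ is → foldr _⊕_ 𝟘 (map (bit ∘ x) is) ≡ times (count x is) 𝟙
    sum-bits []       = refl
    sum-bits (i ∷ is) with x i
    ... | true  = cong (𝟙 ⊕_) (sum-bits is)
    ... | false = trans (R.+-identityˡ _) (sum-bits is)

    count1-bits : 𝟘 ≢ 𝟙 → ∀ is → count1 (map (bit ∘ x) is) ≡ count x is
    count1-bits 𝟘≢𝟙 []       = refl
    count1-bits 𝟘≢𝟙 (i ∷ is) with x i
    ... | true  rewrite dec-true (𝟙 ≟ᶠ 𝟙) refl = cong suc (count1-bits 𝟘≢𝟙 is)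
    ... | false rewrite dec-false (𝟘 ≟ᶠ 𝟙) 𝟘≢𝟙 = count1-bits 𝟘≢𝟙 is

  thresholdBits : ℕ → ℕ → ℕ → List S
  thresholdBits k zero    ℓ = []
  thresholdBits k (suc c) ℓ = bit ⌊ suc k ≤? ℓ ⌋ ∷ thresholdBits (suc k) c ℓ

  sum-thresholdBits : ∀ k c ℓ → foldr _⊕_ 𝟘 (thresholdBits k c ℓ) ≡ times ((ℓ ∸ k) ⊓ c) 𝟙
  sum-thresholdBits k zero    ℓ = cong (λ l → times l 𝟙) (sym (⊓-zeroʳ (ℓ ∸ k)))
  sum-thresholdBits k (suc c) ℓ with suc k ≤? ℓ
  ... | yes k<ℓ = trans (cong (𝟙 ⊕_) (sum-thresholdBits (suc k) c ℓ))
                        (cong (λ l → times (l ⊓ suc c) 𝟙) (sym (∸≡suc∸suc k<ℓ)))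
  ... | no  k≮ℓ = trans (R.+-identityˡ _) (trans (sum-thresholdBits (suc k) c ℓ)
                        (cong (λ l → times l 𝟙) (trans (cong (_⊓ c) (m≤n⇒m∸n≡0 (m≤n⇒m≤1+n ℓ≤k)))
                                                       (sym (cong (_⊓ suc c) (m≤n⇒m∸n≡0 ℓ≤k))))))
    where
      ℓ≤k : ℓ ≤ k
      ℓ≤k = ≤-pred (≰⇒> k≮ℓ)

  WellPlaced : ℕ → Gate → Set
  WellPlaced o g = All (_< o) (args g) × Unique (args g) × ArityOK (kind g) (args g)

  -- The gates gs, placed at nodes o, o + 1, …, are well placed and produce the
  -- values ws when their arguments are read from the complete value table F.
  data Computes (F : List S) : ℕ → List Gate → List S → Set where
    []   : ∀ {o} → Computes F o [] []
    _∷_ : ∀ {o g gs w ws} → WellPlaced o g × gateVal (kind g) (map (lookupD 𝟘 F) (args g)) ≡ w →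
           Computes F (suc o) gs ws → Computes F o (g ∷ gs) (w ∷ ws)

  evalFrom-Computes : ∀ {F gs ws} vals → Computes F (length vals) gs ws → F ≡ vals ++ ws → evalFrom vals gs ≡ F
  evalFrom-Computes vals [] F≡vals = sym (trans F≡vals (++-identityʳ vals))
  evalFrom-Computes {F} {g ∷ gs} {w ∷ ws} vals ((placed , val≡w) ∷ rest) F≡vals =
    subst (λ v → evalFrom (vals ++ [ v ]) gs ≡ F) (sym gate≡w)
      (evalFrom-Computes (vals ++ [ w ])
        (subst (λ o → Computes F o gs ws) (sym (trans (length-++ vals) (+-comm (length vals) 1))) rest)
        (trans F≡vals (sym (++-assoc vals [ w ] ws))))
    where
      args-read-prefix : map (lookupD 𝟘 F) (args g) ≡ map (lookupD 𝟘 vals) (args g)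
      args-read-prefix = trans (cong (λ vs → map (lookupD 𝟘 vs) (args g)) F≡vals)
                               (map-lookupD-++ˡ 𝟘 vals (w ∷ ws) (proj₁ placed))
      gate≡w : gateVal (kind g) (map (lookupD 𝟘 vals) (args g)) ≡ w
      gate≡w = trans (cong (gateVal (kind g)) (sym args-read-prefix)) val≡w

  Computes-++ : ∀ {F o gs gs′ ws ws′} → Computes F o gs ws → Computes F (o + length ws) gs′ ws′ →
                Computes F o (gs ++ gs′) (ws ++ ws′)
  Computes-++ {F} {o} {gs′ = gs′} {ws′ = ws′} [] rest = subst (λ o → Computes F o gs′ ws′) (+-identityʳ o) rest
  Computes-++ {F} {o} {gs′ = gs′} {ws′ = ws′} (_∷_ {ws = ws} c cs) rest =
    c ∷ Computes-++ cs (subst (λ o → Computes F o gs′ ws′) (+-suc o (length ws)) rest)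

  Computes-lookup : ∀ {F o gs ws} → Computes F o gs ws → ∀ j → WellPlaced (o + toℕ j) (lookup gs j)
  Computes-lookup {o = o} {g ∷ _}  ((placed , _) ∷ _) zero    = subst (λ o → WellPlaced o g) (sym (+-identityʳ o)) placed
  Computes-lookup {o = o} {_ ∷ gs} (_ ∷ cs)           (suc j) =
    subst (λ o → WellPlaced o (lookup gs j)) (sym (+-suc o (toℕ j))) (Computes-lookup cs j)

module Construction (𝕊 : FinCSR) (s : Circuits.S 𝕊) (k : ℕ) where
  open FinCSR 𝕊
  open Circuits 𝕊
  private module R = IsCommutativeSemiring isCSR

  p : ℕ
  p = proj₁ (times-eventually-periodic 𝕊 s)

  D : S
  D = times ((k + card) * p) s

  thresholdGates : ℕ → ℕ → ℕ → List Gate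
  thresholdGates n k′ zero     = []
  thresholdGates n k′ (suc c′) = gate (thr (suc k′)) (interval 0 n) ∷ thresholdGates n (suc k′) c′

  outputFormula : ℕ → S → S
  outputFormula ℓ z =
    (foldr _⊕_ 𝟘 (thresholdBits 𝕊 k card ℓ) ⊗ s) ⊕ ((bit ⌊ k + card ≤? ℓ ⌋ ⊗ ((z ⊗ s) ⊕ (D ⊕ 𝟘))) ⊕ 𝟘)

  -- The i-th of these gates is node i + (n + card); the last one computes outputFormula ℓ (ℓ·𝟙)
  -- with ℓ the number of ones.
  finalGates : ℕ → List Gate
  finalGates n =
      gate add (interval 0 n)
    ∷ gate (thr (k + card)) (interval 0 n)
    ∷ gate (const s) []
    ∷ gate (const D) []
    ∷ gate add (interval n card)
    ∷ gate mul (4 + b ∷ 2 + b ∷ [])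
    ∷ gate mul (0 + b ∷ 2 + b ∷ [])
    ∷ gate add (6 + b ∷ 3 + b ∷ [])
    ∷ gate mul (1 + b ∷ 7 + b ∷ [])
    ∷ gate add (5 + b ∷ 8 + b ∷ [])
    ∷ []
    where
      b : ℕ
      b = n + card

  circuit : (n : ℕ) → Circuit n
  circuit n = record { gates = thresholdGates n k card ++ finalGates n ; output = 9 + (n + card) }

  length-thresholdGates : ∀ n k′ c′ → length (thresholdGates n k′ c′) ≡ c′
  length-thresholdGates n k′ zero     = refl
  length-thresholdGates n k′ (suc c′) = cong suc (length-thresholdGates n (suc k′) c′)

  length-thresholdBits : ∀ k′ c′ ℓ → length (thresholdBits 𝕊 k′ c′ ℓ) ≡ c′
  length-thresholdBits k′ zero     ℓ = refl
  length-thresholdBits k′ (suc c′) ℓ = cong suc (length-thresholdBits (suc k′) c′ ℓ)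

  #gates : ∀ n → length (gates (circuit n)) ≡ card + 10
  #gates n = trans (length-++ (thresholdGates n k card)) (cong (_+ 10) (length-thresholdGates n k card))

  combine-cases : ∀ ℓ → times ((ℓ ∸ k) ⊓ card) s ⊕ (bit ⌊ k + card ≤? ℓ ⌋ ⊗ times (ℓ + (k + card) * p) s)
                        ≡ times (ℓ ∸ k) s
  combine-cases ℓ with k + card ≤? ℓ
  ... | no k+card≰ℓ =
    trans (cong₂ _⊕_ (cong (λ l → times l s) (m≤n⇒m⊓n≡m ℓ∸k≤card)) (R.zeroˡ _)) (R.+-identityʳ _)
    where
      ℓ∸k≤card : ℓ ∸ k ≤ card
      ℓ∸k≤card = m≤n+o⇒m∸n≤o ℓ k (<⇒≤ (≰⇒> k+card≰ℓ))
  ... | yes k+card≤ℓ with m≤n⇒∃[o]m+o≡n k+card≤ℓ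
  ...   | t , refl = begin
    times ((ℓ ∸ k) ⊓ card) s ⊕ (𝟙 ⊗ times (ℓ + (k + card) * p) s)
      ≡⟨ cong₂ _⊕_ (cong (λ l → times (l ⊓ card) s) ℓ∸k≡card+t) (R.*-identityˡ _) ⟩
    times ((card + t) ⊓ card) s ⊕ times (ℓ + (k + card) * p) s
      ≡⟨ cong (λ l → times l s ⊕ times (ℓ + (k + card) * p) s) (m≥n⇒m⊓n≡n (m≤m+n card t)) ⟩
    times card s ⊕ times (ℓ + (k + card) * p) s
      ≡⟨ sym (times-+ 𝕊 card _ s) ⟩
    times (card + (ℓ + (k + card) * p)) s
      ≡⟨ cong (λ l → times l s) (rearrange k card t p) ⟩
    times ((card + t) + (k + card) * suc p) s
      ≡⟨ proj₂ (times-eventually-periodic 𝕊 s) (card + t) (k + card) (m≤m+n card t) ⟩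
    times (card + t) s
      ≡⟨ cong (λ l → times l s) (sym ℓ∸k≡card+t) ⟩
    times (ℓ ∸ k) s ∎
    where
      open ≡-Reasoning
      ℓ∸k≡card+t : ℓ ∸ k ≡ card + t
      ℓ∸k≡card+t = trans (cong (_∸ k) (+-assoc k card t)) (m+n∸m≡n k (card + t))
      rearrange : ∀ k c t p → c + ((k + c + t) + (k + c) * p) ≡ (c + t) + (k + c) * suc p
      rearrange = solve-∀

  outputFormula-correct : ∀ ℓ → outputFormula ℓ (times ℓ 𝟙) ≡ times (ℓ ∸ k) s
  outputFormula-correct ℓ =
    trans (cong₂ _⊕_ thresholdPart (trans (R.+-identityʳ _) (cong (bit ⌊ k + card ≤? ℓ ⌋ ⊗_) shiftedPart)))
          (combine-cases ℓ)
    where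
      thresholdPart : foldr _⊕_ 𝟘 (thresholdBits 𝕊 k card ℓ) ⊗ s ≡ times ((ℓ ∸ k) ⊓ card) s
      thresholdPart = trans (cong (_⊗ s) (sum-thresholdBits 𝕊 k card ℓ)) (times-𝟙-⊗ 𝕊 ((ℓ ∸ k) ⊓ card) s)
      shiftedPart : (times ℓ 𝟙 ⊗ s) ⊕ (D ⊕ 𝟘) ≡ times (ℓ + (k + card) * p) s
      shiftedPart = trans (cong₂ _⊕_ (times-𝟙-⊗ 𝕊 ℓ s) (R.+-identityʳ D)) (sym (times-+ 𝕊 ℓ ((k + card) * p) s))

  module Run (n : ℕ) (x : Fin n → Bool) where
    b : ℕ
    b = n + card

    inputs : List S
    inputs = map (bit ∘ x) (allFin n)

    ℓ : ℕ
    ℓ = count1 inputs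

    thresholds : List S
    thresholds = thresholdBits 𝕊 k card ℓ

    w₀ w₁ w₄ w₅ w₆ w₇ w₈ w₉ : S
    w₀ = foldr _⊕_ 𝟘 inputs
    w₁ = bit ⌊ k + card ≤? ℓ ⌋
    w₄ = foldr _⊕_ 𝟘 thresholds
    w₅ = w₄ ⊗ s
    w₆ = w₀ ⊗ s
    w₇ = w₆ ⊕ (D ⊕ 𝟘)
    w₈ = w₁ ⊗ w₇
    w₉ = w₅ ⊕ (w₈ ⊕ 𝟘)

    finalValues : List S
    finalValues = w₀ ∷ w₁ ∷ s ∷ D ∷ w₄ ∷ w₅ ∷ w₆ ∷ w₇ ∷ w₈ ∷ w₉ ∷ []

    table : List S
    table = inputs ++ thresholds ++ finalValues

    length-inputs : length inputs ≡ n
    length-inputs = trans (length-map (bit ∘ x) (allFin n)) (length-tabulate id)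

    read-inputs : map (lookupD 𝟘 table) (interval 0 n) ≡ inputs
    read-inputs = subst (λ m → map (lookupD 𝟘 table) (interval 0 m) ≡ inputs) length-inputs
                        (map-lookupD-interval 𝟘 [] inputs (thresholds ++ finalValues) refl)

    read-thresholds : map (lookupD 𝟘 table) (interval n card) ≡ thresholds
    read-thresholds = subst (λ m → map (lookupD 𝟘 table) (interval n m) ≡ thresholds) (length-thresholdBits k card ℓ)
                            (map-lookupD-interval 𝟘 inputs thresholds finalValues length-inputs)

    read-final : ∀ j → lookupD 𝟘 table (j + b) ≡ lookupD 𝟘 finalValues j
    read-final j = trans (cong (λ vs → lookupD 𝟘 vs (j + b)) (sym (++-assoc inputs thresholds finalValues)))
                         (lookupD-++ʳ 𝟘 (inputs ++ thresholds) finalValues j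
                           (trans (length-++ inputs) (cong₂ _+_ length-inputs (length-thresholdBits k card ℓ))))

    reads-inputs-at : ∀ o → n ≤ o → WellPlaced 𝕊 o (gate add (interval 0 n))
    reads-inputs-at o n≤o = All-interval< 0 n n≤o , interval-unique 0 n , tt

    threshold-run : ∀ k′ c′ o → n ≤ o → Computes 𝕊 table o (thresholdGates n k′ c′) (thresholdBits 𝕊 k′ c′ ℓ)
    threshold-run k′ zero     o n≤o = []
    threshold-run k′ (suc c′) o n≤o =
      (reads-inputs-at o n≤o , cong (λ vs → bit ⌊ suc k′ ≤? count1 vs ⌋) read-inputs)
      ∷ threshold-run (suc k′) c′ (suc o) (m≤n⇒m≤1+n n≤o)

    node< : ∀ i j → {True (i <? j)} → i + b < j + b
    node< i j {i<j} = +-monoˡ-< b (toWitness i<j)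

    distinct : ∀ i j → {False (i ≟ j)} → Unique (i + b ∷ j + b ∷ [])
    distinct i j {i≢j} = ((λ e → toWitnessFalse i≢j (+-cancelʳ-≡ b i j e)) ∷ []) ∷ [] ∷ []

    final-run : Computes 𝕊 table b (finalGates n) finalValues
    final-run =
        (reads-inputs-at b (m≤m+n n card) , cong (foldr _⊕_ 𝟘) read-inputs)
      ∷ (reads-inputs-at (suc b) (m≤n⇒m≤1+n (m≤m+n n card)) , cong (λ vs → bit ⌊ k + card ≤? count1 vs ⌋) read-inputs)
      ∷ (([] , [] , refl) , refl)
      ∷ (([] , [] , refl) , refl)
      ∷ ((All-interval< n card (m≤n+m b 4) , interval-unique n card , tt) , cong (foldr _⊕_ 𝟘) read-thresholds)
      ∷ ((node< 4 5 ∷ node< 2 5 ∷ [] , distinct 4 2 , refl) , cong₂ _⊗_ (read-final 4) (read-final 2))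
      ∷ ((node< 0 6 ∷ node< 2 6 ∷ [] , distinct 0 2 , refl) , cong₂ _⊗_ (read-final 0) (read-final 2))
      ∷ ((node< 6 7 ∷ node< 3 7 ∷ [] , distinct 6 3 , tt)   , cong₂ _⊕_ (read-final 6) (cong (_⊕ 𝟘) (read-final 3)))
      ∷ ((node< 1 8 ∷ node< 7 8 ∷ [] , distinct 1 7 , refl) , cong₂ _⊗_ (read-final 1) (read-final 7))
      ∷ ((node< 5 9 ∷ node< 8 9 ∷ [] , distinct 5 8 , tt)   , cong₂ _⊕_ (read-final 5) (cong (_⊕ 𝟘) (read-final 8)))
      ∷ []

    run : Computes 𝕊 table n (gates (circuit n)) (thresholds ++ finalValues)
    run = Computes-++ 𝕊 (threshold-run k card n ≤-refl)
            (subst (λ m → Computes 𝕊 table (n + m) (finalGates n) finalValues) (sym (length-thresholdBits k card ℓ)) final-run)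

    values≡table : values (circuit n) x ≡ table
    values≡table = evalFrom-Computes 𝕊 inputs
      (subst (λ o → Computes 𝕊 table o (gates (circuit n)) (thresholds ++ finalValues)) (sym length-inputs) run) refl

    output-correct : outputVal (circuit n) x ≡ times (ones x ∸ k) s
    output-correct with 𝟘 ≟ᶠ 𝟙
    ... | yes 𝟘≡𝟙 = 𝟘≡𝟙⇒trivial 𝕊 𝟘≡𝟙 _ _
    ... | no  𝟘≢𝟙 = begin
      outputVal (circuit n) x          ≡⟨ cong (λ vs → lookupD 𝟘 vs (9 + b)) values≡table ⟩
      lookupD 𝟘 table (9 + b)          ≡⟨ read-final 9 ⟩
      outputFormula ℓ w₀               ≡⟨ cong₂ outputFormula (count1-bits 𝕊 x 𝟘≢𝟙 (allFin n)) (sum-bits 𝕊 x (allFin n)) ⟩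
      outputFormula (ones x) (times (ones x) 𝟙) ≡⟨ outputFormula-correct (ones x) ⟩
      times (ones x ∸ k) s             ∎
      where open ≡-Reasoning

    ReadsBooleans : Gate → Set
    ReadsBooleans g = IsCounting (kind g) → All (λ i → IsBool (lookupD 𝟘 table i)) (args g)

    inputs-boolean : All (λ i → IsBool (lookupD 𝟘 table i)) (interval 0 n)
    inputs-boolean = map⁻ (subst (All IsBool) (sym read-inputs) (map⁺ (universal (λ i → bit-boolean (x i)) (allFin n))))
      where
        bit-boolean : ∀ β → IsBool (bit β)
        bit-boolean true  = inj₂ refl
        bit-boolean false = inj₁ refl

    threshold-reads-booleans : ∀ k′ c′ → All ReadsBooleans (thresholdGates n k′ c′)
    threshold-reads-booleans k′ zero     = []
    threshold-reads-booleans k′ (suc c′) = (λ _ → inputs-boolean) ∷ threshold-reads-booleans (suc k′) c′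

    reads-booleans : All ReadsBooleans (gates (circuit n))
    reads-booleans = ++⁺ (threshold-reads-booleans k card)
      ((λ ()) ∷ (λ _ → inputs-boolean) ∷ (λ ()) ∷ (λ ()) ∷ (λ ()) ∷ (λ ()) ∷ (λ ()) ∷ (λ ()) ∷ (λ ()) ∷ (λ ()) ∷ [])

  counting-inputs-boolean : ∀ n → CountingInputsBoolean (circuit n)
  counting-inputs-boolean n x j rewrite Run.values≡table n x = All.lookup (Run.reads-booleans n x) (∈-lookup j)

  well-formed : ∀ n → WellFormed (circuit n)
  well-formed n = Computes-lookup 𝕊 (Run.run n (λ _ → false))
                , subst (λ m → 9 + (n + card) < n + m) (sym (#gates n)) (≤-reflexive (solve n card))
    where
      solve : ∀ n c → suc (9 + (n + c)) ≡ n + (c + 10)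
      solve = solve-∀

  thresholds-bounded : ∀ n k′ c′ → k′ + c′ ≤ 1 * (card + k) →
                       All (λ g → KindOK (1 * (card + k)) (kind g)) (thresholdGates n k′ c′)
  thresholds-bounded n k′ zero     _      = []
  thresholds-bounded n k′ (suc c′) bound rewrite +-suc k′ c′ =
    ≤-trans (s≤s (m≤m+n k′ c′)) bound ∷ thresholds-bounded n (suc k′) c′ bound

  kinds-bounded : ∀ n → All (λ g → KindOK (1 * (card + k)) (kind g)) (gates (circuit n))
  kinds-bounded n = ++⁺ (thresholds-bounded n k card k+card≤)
                        (tt ∷ k+card≤ ∷ tt ∷ tt ∷ tt ∷ tt ∷ tt ∷ tt ∷ tt ∷ tt ∷ [])
    where
      k+card≤ : k + card ≤ 1 * (card + k)
      k+card≤ = ≤-reflexive (trans (+-comm k card) (sym (*-identityˡ (card + k))))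

lemma15 : ∃[ a ] ((𝕊 : FinCSR) → (s : Circuits.S 𝕊) → (k : ℕ) →
    ∃[ C ] ( (∀ n → Circuits.WellFormed 𝕊 (C n))
    × (∀ n → Circuits.CountingInputsBoolean 𝕊 (C n))
    × (∀ n x → Circuits.outputVal 𝕊 (C n) x ≡ Circuits.times 𝕊 (Circuits.ones 𝕊 x ∸ k) s)
    × Circuits.BoundedDepth 𝕊 C
    × Circuits.BoundedFanOut 𝕊 C
    × Circuits.BoundedExpansion 𝕊 C
    × (∀ n → All (λ g → Circuits.KindOK 𝕊 (a * (FinCSR.card 𝕊 + k)) (Circuits.kind g)) (Circuits.gates (C n)))))
lemma15 = 1 , λ 𝕊 s k →
  let open Circuits 𝕊
      open Construction 𝕊 s k
      M : ℕ
      M = FinCSR.card 𝕊 + 10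
  in circuit , well-formed , counting-inputs-boolean , (λ n x → Run.output-correct n x)
   , (M , λ n → subst (depth (circuit n) ≤_) (#gates n) (depth≤#gates 𝕊 (circuit n)))
   , (M , λ n i → subst (outdeg (circuit n) i ≤_) (#gates n) (outdeg≤#gates 𝕊 (circuit n) i))
   , (λ r → M + M , λ n H → subst (λ m → ShallowMinor.edgeCount H ≤ (m + m) * ShallowMinor.k H) (#gates n)
                                  (edgeCount≤2#gates*k 𝕊 (circuit n) H))
   , kinds-bounded
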